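{- For all cathoristic models $\mathfrak{M}_1,\mathfrak{M}_2$: $\mathfrak{M}_1\sim\mathfrak{M}_2$ if and only if $\mathfrak{M}_1\simeq\mathfrak{M}_2$.
   Context: Fix a non-empty set $\Sigma$ of actions. A cathoristic transition system is a triple $\mathcal{L}=(S,\rightarrow,\lambda)$ where $\rightarrow\subseteq S\times\Sigma\times S$ is deterministic ($s\xrightarrow{a}t$ and $s\xrightarrow{a}t'$ imply $t=t'$) and $\lambda$ maps each state to a subset of $\Sigma$, with $\{a\mid\exists t.\, s\xrightarrow{a}t\}\subseteq\lambda(s)$ for every $s$ and every $\lambda(s)$ either finite or equal to $\Sigma$. A cathoristic model is a pair $(\mathcal{L},s)$ with $s$ a state of $\mathcal{L}$. For $\mathcal{L}_i=(S_i,\rightarrow_i,\lambda_i)$, a simulation from $\mathcal{L}_1$ to $\mathcal{L}_2$ is $R\subseteq S_1\times S_2$ such that whenever $(x,y)\in R$ and $x\xrightarrow{a}_1x'$ there is $y'$ with $y\xrightarrow{a}_2y'$ and $(x',y')\in R$, and $\lambda_1(x)\supseteq\lambda_2(y)$ for all $(x,y)\in R$; a simulation from model $(\mathcal{L}_1,s_1)$ to $(\mathcal{L}_2,s_2)$ additionally contains $(s_1,s_2)$. $\mathfrak{M}_1\simeq\mathfrak{M}_2$ means there is a simulation from $\mathfrak{M}_1$ to $\mathfrak{M}_2$ and one from $\mathfrak{M}_2$ to $\mathfrak{M}_1$. A bisimulation between $\mathfrak{M}_1$ and $\mathfrak{M}_2$ is a relation $R$ such that $R$ is a simulation from $\mathfrak{M}_1$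 to $\mathfrak{M}_2$ and $R^{ -1}$ is a simulation from $\mathfrak{M}_2$ to $\mathfrak{M}_1$; $\mathfrak{M}_1\sim\mathfrak{M}_2$ means such a bisimulation exists. -}

module Defs where

open import Data.List using (List)
open import Data.List.Membership.Propositional using (_∈_)
open import Data.Maybe using (Maybe; just; nothing)
open import Data.Product using (Σ; _×_; ∃; ∃-syntax)
open import Data.Unit using (⊤)
open import Relation.Binary.PropositionalEquality using (_≡_)

-- The label λ(s) is either finite (a list of actions) or all of Σ (nothing).
-- This encodes the constraint "λ(s) finite or equal to Σ".
data Label (A : Set) : Set where
  fin : List A → Label A
  all : Label A

_∈L_ : {A : Set} → A → Label A → Set
a ∈L fin l = a ∈ l
a ∈L all   = ⊤

record CTS (A : Set) : Set₁ where
  field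
    State : Set
    _⟶[_]_ : State → A → State → Set
    deterministic : ∀ {s a t t'} → s ⟶[ a ] t → s ⟶[ a ] t' → t ≡ t'
    lab : State → Label A
    enabled⊆lab : ∀ {s a t} → s ⟶[ a ] t → a ∈L lab s
open CTS public

record Model (A : Set) : Set₁ where
  constructor ⟨_,_⟩
  field
    lts : CTS A
    start : State lts
open Model public

IsSimulation : {A : Set} (L₁ L₂ : CTS A) → (State L₁ → State L₂ → Set) → Set
IsSimulation {A} L₁ L₂ R =
  (∀ {x y a x'} → R x y → _⟶[_]_ L₁ x a x' →
     ∃[ y' ] (_⟶[_]_ L₂ y a y' × R x' y'))
  × (∀ {x y} → R x y → ∀ (a : A) → a ∈L lab L₂ y → a ∈L lab L₁ x)

IsModelSimulation : {A : Set} (M₁ M₂ : Model A) →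
  (State (lts M₁) → State (lts M₂) → Set) → Set
IsModelSimulation M₁ M₂ R = IsSimulation (lts M₁) (lts M₂) R × R (start M₁) (start M₂)

converse : {X Y : Set} → (X → Y → Set) → (Y → X → Set)
converse R y x = R x y

_≃_ : {A : Set} → Model A → Model A → Set₁
M₁ ≃ M₂ = (∃[ R ] IsModelSimulation M₁ M₂ R) × (∃[ R ] IsModelSimulation M₂ M₁ R)

_∼_ : {A : Set} → Model A → Model A → Set₁
M₁ ∼ M₂ = ∃[ R ] (IsModelSimulation M₁ M₂ R × IsModelSimulation M₂ M₁ (converse R))

-- A bisimulation yields a simulation in each direction (itself and its
-- converse), so bisimilarity implies mutual similarity.  The converse is
-- where determinism enters.  Given simulations R : L₁ → L₂ and S : L₂ → L₁,
-- consider the relation B x y = R x y × S y x.  If x --a--> x', then R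
-- provides y --a--> y' with R x' y', and S provides x --a--> x'' with
-- S y' x''; determinism of L₁ forces x'' = x', so B x' y'.  Hence B is a
-- simulation from L₁ to L₂ (lemma `pairedSimulation`), and by symmetry its
-- converse is a simulation from L₂ to L₁.  Since B contains the pair of
-- start states whenever R and S do, B is a bisimulation.  The symmetry step
-- needs that simulations are closed under pointwise-equivalent relations
-- (lemma `simulation-resp-⇔`), as the converse of B is B with its two
-- components swapped.
module Submission where

open import Defs
open import Data.Product using (_×_; _,_; ∃-syntax; swap)
open import Relation.Binary.PropositionalEquality using (subst)

simulation-resp-⇔ : {A : Set} (L₁ L₂ : CTS A) {R R' : State L₁ → State L₂ → Set} →
  (∀ {x y} → R x y → R' x y) → (∀ {x y} → R' x y → R x y) →
  IsSimulation L₁ L₂ R → IsSimulation L₁ L₂ R'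
simulation-resp-⇔ _ _ to from (step , labels) =
  (λ r' t → let (y' , u , r) = step (from r') t in y' , u , to r) ,
  (λ r' → labels (from r'))

pairedSimulation : {A : Set} (L₁ L₂ : CTS A)
  {R : State L₁ → State L₂ → Set} {S : State L₂ → State L₁ → Set} →
  IsSimulation L₁ L₂ R → IsSimulation L₂ L₁ S →
  IsSimulation L₁ L₂ (λ x y → R x y × S y x)
pairedSimulation L₁ L₂ {R} {S} (stepR , labelsR) (stepS , _) =
  matchStep , λ (r , _) → labelsR r
  where
  matchStep : ∀ {x y a x'} → R x y × S y x → _⟶[_]_ L₁ x a x' →
    ∃[ y' ] (_⟶[_]_ L₂ y a y' × (R x' y' × S y' x'))
  matchStep (r , s) t with stepR r t
  ... | y' , u , r' with stepS s u
  ... | _ , t' , s' = y' , u , r' , subst (S y') (deterministic L₁ t' t) s'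

bisimilar⇒similar : {A : Set} (M₁ M₂ : Model A) → M₁ ∼ M₂ → M₁ ≃ M₂
bisimilar⇒similar _ _ (R , forward , backward) = (R , forward) , (converse R , backward)

similar⇒bisimilar : {A : Set} (M₁ M₂ : Model A) → M₁ ≃ M₂ → M₁ ∼ M₂
similar⇒bisimilar M₁ M₂ ((R , simR , r₀) , (S , simS , s₀)) =
  paired , (forward , r₀ , s₀) , (backward , r₀ , s₀)
  where
  paired : State (lts M₁) → State (lts M₂) → Set
  paired x y = R x y × S y x

  forward : IsSimulation (lts M₁) (lts M₂) paired
  forward = pairedSimulation (lts M₁) (lts M₂) simR simS

  backward : IsSimulation (lts M₂) (lts M₁) (converse paired)
  backward = simulation-resp-⇔ (lts M₂) (lts M₁) swap swap
    (pairedSimulation (lts M₂) (lts M₁) simS simR)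

mainTheorem2 : {A : Set} → A → (M₁ M₂ : Model A) → ((M₁ ∼ M₂ → M₁ ≃ M₂) × (M₁ ≃ M₂ → M₁ ∼ M₂))
mainTheorem2 _ M₁ M₂ = bisimilar⇒similar M₁ M₂ , similar⇒bisimilar M₁ M₂
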